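{- For infinitely many positive integers $n$ we have $$N_{prod}(n,2,n-2,1)>\widehat{N}_{prod}(n,2,n-2,1).$$
   Context: $\binom{[n]}{m}$ denotes the set of all $m$-element subsets of $[n]=\{1,\dots,n\}$. A family $\mathcal{F}$ of subsets of $[n]$ is $m$-uniform if $\mathcal{F}\subseteq\binom{[n]}{m}$. Families $\mathcal{F},\mathcal{G}$ are cross-$t$-intersecting if $|F\cap G|\ge t$ for all $F\in\mathcal{F},G\in\mathcal{G}$. $N_{prod}(n,a,b,t)$ is the maximum of $|\mathcal{F}|\cdot|\mathcal{G}|$ over all pairs with $\mathcal{F}$ $a$-uniform, $\mathcal{G}$ $b$-uniform, and $\mathcal{F},\mathcal{G}$ cross-$t$-intersecting. $\widehat{N}_{prod}(n,a,b,t)$ is the maximum of $|\mathcal{F}|\cdot|\mathcal{G}|$ over pairs of the form $\mathcal{F}=\{F\in\binom{[n]}{a}:|F\cap[s]|\ge u\}$, $\mathcal{G}=\{G\in\binom{[n]}{b}:|G\cap[s]|\ge v\}$ with $u,v,s\in[n]$ and $u+v=s+t$. -}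

module Defs where

open import Data.Nat using (ℕ; zero; suc; _+_; _*_; _≤_; _<_; _≤ᵇ_; _<ᵇ_; _≡ᵇ_)
open import Data.Bool using (Bool; true; false; _∧_)
open import Data.Fin using (Fin; toℕ)
open import Data.Fin.Subset using (Subset; ∣_∣; _∩_; inside; outside)
open import Data.Vec using (Vec; []; _∷_; tabulate)
open import Data.List using (List; []; _∷_; map; _++_; length; filterᵇ)
open import Data.List.Relation.Unary.All using (All)
open import Data.List.Relation.Unary.Unique.Propositional using (Unique)
open import Data.Product using (Σ; _×_; ∃; ∃-syntax; _,_)
open import Relation.Binary.PropositionalEquality using (_≡_)

allSubsets : (n : ℕ) → List (Subset n)
allSubsets zero    = [] ∷ []
allSubsets (suc n) = map (outside ∷_) (allSubsets n) ++ map (inside ∷_) (allSubsets n)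

-- The initial segment [s] = {1,…,s}, i.e. elements i of Fin n with toℕ i < s.
initSeg : (n s : ℕ) → Subset n
initSeg n s = tabulate (λ i → toℕ i <ᵇ s)

-- A family of subsets of [n]: a duplicate-free list; its size is its length.
Family : ℕ → Set
Family n = List (Subset n)

IsFamily : ∀ {n} → Family n → Set
IsFamily F = Unique F

Uniform : ∀ {n} → ℕ → Family n → Set
Uniform m F = All (λ A → ∣ A ∣ ≡ m) F

CrossInt : ∀ {n} → ℕ → Family n → Family n → Set
CrossInt t F G = All (λ A → All (λ B → t ≤ ∣ A ∩ B ∣) G) F

Admissible : (n a b t : ℕ) → Family n → Family n → Set
Admissible n a b t F G =
  IsFamily F × IsFamily G × Uniform a F × Uniform b G × CrossInt t F G

IsNprod : (n a b t N : ℕ) → Set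
IsNprod n a b t N =
  (Σ (Family n) λ F → Σ (Family n) λ G → Admissible n a b t F G × length F * length G ≡ N)
  × (∀ (F G : Family n) → Admissible n a b t F G → length F * length G ≤ N)

hatFamily : (n a s u : ℕ) → Family n
hatFamily n a s u =
  filterᵇ (λ A → (∣ A ∣ ≡ᵇ a) ∧ (u ≤ᵇ ∣ A ∩ initSeg n s ∣)) (allSubsets n)

HatParams : (n t u v s : ℕ) → Set
HatParams n t u v s =
  (1 ≤ u × u ≤ n) × (1 ≤ v × v ≤ n) × (1 ≤ s × s ≤ n) × u + v ≡ s + t

hatProd : (n a b u v s : ℕ) → ℕ
hatProd n a b u v s = length (hatFamily n a s u) * length (hatFamily n b s v)

IsNhat : (n a b t N : ℕ) → Set
IsNhat n a b t N =
  (∃[ u ] ∃[ v ] ∃[ s ] HatParams n t u v s × hatProd n a b u v s ≡ N)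
  × (∀ u v s → HatParams n t u v s → hatProd n a b u v s ≤ N)

-- Split [n] into [s] and its complement, of size t. The 2-sets meeting both parts and the
-- (n − 2)-sets containing one of the parts are cross-intersecting, of sizes s t and C(s,2) + C(t,2);
-- these agree when (s − t)² = s + t, e.g. for consecutive triangular numbers s, t, and then
-- their product is x² with x = s t and C(n,2) = 2x.
-- A hat pair for a = 2, b = n − 2 splits [n] at some r into r and t′ = n − r. For u = 1 its sizes
-- are (r t′ + C(r,2), C(t′,2)), for u = 2 they are (C(r,2), r t′ + C(t′,2)), and for u ≥ 3 the
-- first family is empty. In the first two cases the sizes add up to C(n,2) = 2x and one of them is a
-- triangular number, so their product is below x² as soon as x is not triangular. Choosing
-- s ≡ 6 and t ≡ 3 (mod 7) makes x ≡ 4 (mod 7), which no triangular number is.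

module Submission where

open import Data.Bool using (Bool; true; false; _∧_; _∨_; if_then_else_; T)
open import Data.Bool.Properties using (∧-comm; ∧-distribˡ-∨; ∧-zeroʳ; T-∧; T-∨)
open import Data.Empty using (⊥)
open import Data.Fin.Subset using (Subset; ∣_∣; _∩_; ∁; inside; outside)
open import Data.Fin.Subset.Properties using (∣∁p∣≡n∸∣p∣)
open import Data.List using ([]; _∷_; map; _++_; length; filterᵇ)
open import Data.List.Properties using (length-++; filter-++)
open import Data.List.Membership.Propositional using (_∈_)
open import Data.List.Membership.Propositional.Properties using (∈-map⁻)
open import Data.List.Relation.Unary.All as All using (All)
open import Data.List.Relation.Unary.All.Properties using (all-filter)
open import Data.List.Relation.Unary.Unique.Propositional using (Unique; []; _∷_)
import Data.List.Relation.Unary.Unique.Propositional.Properties as Unique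
open import Data.Nat
open import Data.Nat.Combinatorics using (_C_; nCn≡1; nC1≡n; nCk≡nC[n∸k]; nCk+nC[k+1]≡[n+1]C[k+1]; k>n⇒nCk≡0)
open import Data.Nat.DivMod using ([m+kn]%n≡m%n; %-distribˡ-*)
open import Data.Nat.Properties
open import Algebra.Properties.CommutativeSemigroup +-commutativeSemigroup using (interchange)
open import Data.Nat.Tactic.RingSolver using (solve-∀)
open import Data.Product using (∃-syntax; _×_; _,_; proj₁; proj₂; map₁)
open import Data.Sum using (_⊎_; inj₁; inj₂)
open import Data.Vec using ([]; _∷_)
open import Data.Vec.Properties using (∷-injectiveʳ)
open import Function using (_∘_)
open import Function.Bundles using (Equivalence)
open import Relation.Binary using (tri<; tri≈; tri>)
open import Relation.Binary.PropositionalEquality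
open import Relation.Nullary using (¬_; contradiction; yes; no)
open import Relation.Nullary.Decidable.Core using (T?)

open import Defs
Profile : Set
Profile = ℕ → ℕ → Bool

profileFamily : (n s : ℕ) → Profile → Family n
profileFamily n s P = filterᵇ (λ A → P ∣ A ∩ initSeg n s ∣ ∣ A ∣) (allSubsets n)

profileCount : ℕ → ℕ → Profile → ℕ
profileCount zero    s       P = if P 0 0 then 1 else 0
profileCount (suc n) zero    P = profileCount n zero P + profileCount n zero (λ i k → P i (suc k))
profileCount (suc n) (suc s) P = profileCount n s P + profileCount n s (λ i k → P (suc i) (suc k))

length-filterᵇ-map : ∀ {A B : Set} (p : B → Bool) (f : A → B) xs →
                     length (filterᵇ p (map f xs)) ≡ length (filterᵇ (p ∘ f) xs)
length-filterᵇ-map p f []       = refl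
length-filterᵇ-map p f (x ∷ xs) with p (f x)
... | true  = cong suc (length-filterᵇ-map p f xs)
... | false = length-filterᵇ-map p f xs

length-filterᵇ-allSubsets : ∀ n (p : Subset (suc n) → Bool) →
  length (filterᵇ p (allSubsets (suc n))) ≡
  length (filterᵇ (p ∘ (outside ∷_)) (allSubsets n)) + length (filterᵇ (p ∘ (inside ∷_)) (allSubsets n))
length-filterᵇ-allSubsets n p = begin
  length (filterᵇ p (outsides ++ insides))
    ≡⟨ cong length (filter-++ (T? ∘ p) outsides insides) ⟩
  length (filterᵇ p outsides ++ filterᵇ p insides)
    ≡⟨ length-++ (filterᵇ p outsides) ⟩
  length (filterᵇ p outsides) + length (filterᵇ p insides)
    ≡⟨ cong₂ _+_ (length-filterᵇ-map p _ (allSubsets n)) (length-filterᵇ-map p _ (allSubsets n)) ⟩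
  _ ∎
  where
  open ≡-Reasoning
  outsides = map (outside ∷_) (allSubsets n)
  insides  = map (inside ∷_) (allSubsets n)

length-profileFamily : ∀ n s P → length (profileFamily n s P) ≡ profileCount n s P
length-profileFamily zero s P with P 0 0
... | true  = refl
... | false = refl
length-profileFamily (suc n) zero P =
  trans (length-filterᵇ-allSubsets n _)
        (cong₂ _+_ (length-profileFamily n zero P) (length-profileFamily n zero _))
length-profileFamily (suc n) (suc s) P =
  trans (length-filterᵇ-allSubsets n _)
        (cong₂ _+_ (length-profileFamily n s P) (length-profileFamily n s _))

profileCount-cong : ∀ n s {P Q : Profile} → (∀ i k → P i k ≡ Q i k) →
                    profileCount n s P ≡ profileCount n s Q
profileCount-cong zero    s       P≗Q = cong (λ b → if b then 1 else 0) (P≗Q 0 0)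
profileCount-cong (suc n) zero    P≗Q =
  cong₂ _+_ (profileCount-cong n zero P≗Q) (profileCount-cong n zero (λ i k → P≗Q i (suc k)))
profileCount-cong (suc n) (suc s) P≗Q =
  cong₂ _+_ (profileCount-cong n s P≗Q) (profileCount-cong n s (λ i k → P≗Q (suc i) (suc k)))

profileCount-empty : ∀ n s {P : Profile} → (∀ i k → i ≤ s → i ≤ k → P i k ≡ false) →
                     profileCount n s P ≡ 0
profileCount-empty zero    s       P≡false rewrite P≡false 0 0 z≤n z≤n = refl
profileCount-empty (suc n) zero    P≡false =
  cong₂ _+_ (profileCount-empty n zero P≡false)
            (profileCount-empty n zero (λ i k i≤0 i≤k → P≡false i (suc k) i≤0 (m≤n⇒m≤1+n i≤k)))
profileCount-empty (suc n) (suc s) P≡false =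
  cong₂ _+_ (profileCount-empty n s (λ i k i≤s → P≡false i k (m≤n⇒m≤1+n i≤s)))
            (profileCount-empty n s (λ i k i≤s i≤k → P≡false (suc i) (suc k) (s≤s i≤s) (s≤s i≤k)))

profileCount-∨ : ∀ n s {P Q : Profile} → (∀ i k → P i k ∧ Q i k ≡ false) →
                 profileCount n s (λ i k → P i k ∨ Q i k) ≡ profileCount n s P + profileCount n s Q
profileCount-∨ zero s {P} {Q} disjoint with P 0 0 | Q 0 0 | disjoint 0 0
... | true  | true  | ()
... | true  | false | _ = refl
... | false | _     | _ = refl
profileCount-∨ (suc n) zero {P} disjoint =
  trans (cong₂ _+_ (profileCount-∨ n zero disjoint) (profileCount-∨ n zero (λ i k → disjoint i (suc k))))
        (interchange (profileCount n zero P) _ _ _)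
profileCount-∨ (suc n) (suc s) {P} disjoint =
  trans (cong₂ _+_ (profileCount-∨ n s disjoint) (profileCount-∨ n s (λ i k → disjoint (suc i) (suc k))))
        (interchange (profileCount n s P) _ _ _)

allSubsets-unique : ∀ n → Unique (allSubsets n)
allSubsets-unique zero    = All.[] ∷ []
allSubsets-unique (suc n) =
  Unique.++⁺ (Unique.map⁺ ∷-injectiveʳ (allSubsets-unique n)) (Unique.map⁺ ∷-injectiveʳ (allSubsets-unique n)) disjoint
  where
  disjoint : ∀ {A} → A ∈ map (outside ∷_) (allSubsets n) × A ∈ map (inside ∷_) (allSubsets n) → ⊥
  disjoint (A∈outsides , A∈insides) with ∈-map⁻ (outside ∷_) A∈outsides | ∈-map⁻ (inside ∷_) A∈insides
  ... | _ , _ , refl | _ , _ , ()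

profileFamily-unique : ∀ n s P → Unique (profileFamily n s P)
profileFamily-unique n s P = Unique.filter⁺ (λ A → T? (P ∣ A ∩ initSeg n s ∣ ∣ A ∣)) (allSubsets-unique n)

profileFamily-All : ∀ n s P {Q : Subset n → Set} → (∀ A → T (P ∣ A ∩ initSeg n s ∣ ∣ A ∣) → Q A) →
                    All Q (profileFamily n s P)
profileFamily-All n s P PA⇒QA = All.map (PA⇒QA _) (all-filter (λ A → T? (P ∣ A ∩ initSeg n s ∣ ∣ A ∣)) (allSubsets n))

exactly : ℕ → ℕ → Profile
exactly p k i k′ = (i ≡ᵇ p) ∧ (k′ ≡ᵇ k)

profileCount-exactly-outside : ∀ t q → profileCount t 0 (exactly 0 q) ≡ t C q
profileCount-exactly-outside zero    zero    = refl
profileCount-exactly-outside zero    (suc q) = refl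
profileCount-exactly-outside (suc t) zero    =
  cong₂ _+_ (profileCount-exactly-outside t 0) (profileCount-empty t 0 (λ i k _ _ → ∧-zeroʳ (i ≡ᵇ 0)))
profileCount-exactly-outside (suc t) (suc q) =
  trans (cong₂ _+_ (profileCount-exactly-outside t (suc q)) (profileCount-exactly-outside t q))
        (trans (+-comm (t C suc q) _) (nCk+nC[k+1]≡[n+1]C[k+1] t q))

profileCount-exactly : ∀ s t p q {k} → p + q ≡ k → profileCount (s + t) s (exactly p k) ≡ (s C p) * (t C q)
profileCount-exactly zero    t zero    q refl = trans (profileCount-exactly-outside t q) (sym (*-identityˡ _))
profileCount-exactly zero    t (suc p) q refl =
  profileCount-empty t 0 (λ i k i≤0 _ → cong (λ i → exactly (suc p) (suc p + q) i k) (n≤0⇒n≡0 i≤0))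
profileCount-exactly (suc s) t zero    q refl =
  trans (cong₂ _+_ (profileCount-exactly s t 0 q refl) (profileCount-empty (s + t) s (λ _ _ _ _ → refl)))
        (+-identityʳ _)
profileCount-exactly (suc s) t (suc p) q refl = begin
  profileCount (s + t) s (exactly (suc p) (suc p + q)) + profileCount (s + t) s (exactly p (p + q))
    ≡⟨ cong₂ _+_ (profileCount-exactly s t (suc p) q refl) (profileCount-exactly s t p q refl) ⟩
  (s C suc p) * (t C q) + (s C p) * (t C q)
    ≡⟨ +-comm ((s C suc p) * (t C q)) _ ⟩
  (s C p) * (t C q) + (s C suc p) * (t C q)
    ≡⟨ *-distribʳ-+ (t C q) (s C p) (s C suc p) ⟨
  (s C p + s C suc p) * (t C q)
    ≡⟨ cong (_* (t C q)) (nCk+nC[k+1]≡[n+1]C[k+1] s p) ⟩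
  (suc s C suc p) * (t C q)
    ∎
  where open ≡-Reasoning

¬T⇒≡false : ∀ {b} → ¬ T b → b ≡ false
¬T⇒≡false {false} _  = refl
¬T⇒≡false {true}  ¬T = contradiction _ ¬T

exactly-sound : ∀ p k i k′ → T (exactly p k i k′) → i ≡ p × k′ ≡ k
exactly-sound p k i k′ inExactly =
  let i≡ᵇp , k′≡ᵇk = Equivalence.to T-∧ inExactly in ≡ᵇ⇒≡ i p i≡ᵇp , ≡ᵇ⇒≡ k′ k k′≡ᵇk

exactly-disjoint : ∀ {p p′} → p ≢ p′ → ∀ k i k′ → exactly p k i k′ ∧ exactly p′ k i k′ ≡ false
exactly-disjoint {p} {p′} p≢p′ k i k′ = ¬T⇒≡false λ inBoth →
  let inP , inP′ = Equivalence.to T-∧ inBoth in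
  p≢p′ (trans (sym (proj₁ (exactly-sound p k i k′ inP))) (proj₁ (exactly-sound p′ k i k′ inP′)))

atLeast : ℕ → ℕ → Profile
atLeast a u i k = (k ≡ᵇ a) ∧ (u ≤ᵇ i)

≤ᵇ-unfold : ∀ u i → (u ≤ᵇ i) ≡ (i ≡ᵇ u) ∨ (suc u ≤ᵇ i)
≤ᵇ-unfold zero          zero    = refl
≤ᵇ-unfold zero          (suc i) = refl
≤ᵇ-unfold (suc u)       zero    = refl
≤ᵇ-unfold (suc zero)    (suc i) = ≤ᵇ-unfold zero i
≤ᵇ-unfold (suc (suc u)) (suc i) = ≤ᵇ-unfold (suc u) i

atLeast-unfold : ∀ a u i k → atLeast a u i k ≡ exactly u a i k ∨ atLeast a (suc u) i k
atLeast-unfold a u i k = begin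
  (k ≡ᵇ a) ∧ (u ≤ᵇ i)                                ≡⟨ cong ((k ≡ᵇ a) ∧_) (≤ᵇ-unfold u i) ⟩
  (k ≡ᵇ a) ∧ ((i ≡ᵇ u) ∨ (u <ᵇ i))                   ≡⟨ ∧-distribˡ-∨ (k ≡ᵇ a) (i ≡ᵇ u) _ ⟩
  (k ≡ᵇ a) ∧ (i ≡ᵇ u) ∨ (k ≡ᵇ a) ∧ (u <ᵇ i)          ≡⟨ cong (_∨ (k ≡ᵇ a) ∧ (u <ᵇ i)) (∧-comm (k ≡ᵇ a) (i ≡ᵇ u)) ⟩
  (i ≡ᵇ u) ∧ (k ≡ᵇ a) ∨ (k ≡ᵇ a) ∧ (u <ᵇ i)          ∎
  where open ≡-Reasoning

exactly-atLeast-disjoint : ∀ a u i k → exactly u a i k ∧ atLeast a (suc u) i k ≡ false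
exactly-atLeast-disjoint a u i k = ¬T⇒≡false λ inBoth →
  let inExactly , inAtLeast = Equivalence.to T-∧ inBoth in
  <-irrefl (sym (proj₁ (exactly-sound u a i k inExactly))) (≤ᵇ⇒≤ (suc u) i (proj₂ (Equivalence.to T-∧ inAtLeast)))

profileCount-atLeast-unfold : ∀ n s a u →
  profileCount n s (atLeast a u) ≡ profileCount n s (exactly u a) + profileCount n s (atLeast a (suc u))
profileCount-atLeast-unfold n s a u =
  trans (profileCount-cong n s (atLeast-unfold a u)) (profileCount-∨ n s (exactly-atLeast-disjoint a u))

atLeast-false : ∀ a u i k → (k ≡ a → i < u) → atLeast a u i k ≡ false
atLeast-false a u i k i<u = ¬T⇒≡false λ inAtLeast →
  let k≡ᵇa , u≤ᵇi = Equivalence.to T-∧ inAtLeast in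
  <⇒≱ (i<u (≡ᵇ⇒≡ k a k≡ᵇa)) (≤ᵇ⇒≤ u i u≤ᵇi)

profileCount-atLeast-empty : ∀ n s a u → (∀ i k → i ≤ s → i ≤ k → k ≡ a → i < u) →
                             profileCount n s (atLeast a u) ≡ 0
profileCount-atLeast-empty n s a u i<u =
  profileCount-empty n s (λ i k i≤s i≤k → atLeast-false a u i k (i<u i k i≤s i≤k))

profileCount-atLeast-last : ∀ n s a u → (∀ i k → i ≤ s → i ≤ k → k ≡ a → i ≤ u) →
                            profileCount n s (atLeast a u) ≡ profileCount n s (exactly u a)
profileCount-atLeast-last n s a u i≤u =
  trans (profileCount-atLeast-unfold n s a u)
        (trans (cong (profileCount n s (exactly u a) +_) (profileCount-atLeast-empty n s a (suc u) i<1+u))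
               (+-identityʳ _))
  where
  i<1+u : ∀ i k → i ≤ s → i ≤ k → k ≡ a → i < suc u
  i<1+u i k i≤s i≤k k≡a = s≤s (i≤u i k i≤s i≤k k≡a)

C-∸ : ∀ {n k} → k ≤ n → n C (n ∸ k) ≡ n C k
C-∸ {n} {k} k≤n = trans (nCk≡nC[n∸k] (m∸n≤m n k)) (cong (n C_) (m∸[m∸n]≡n k≤n))

C2-suc : ∀ m → suc m C 2 ≡ m + m C 2
C2-suc m = trans (sym (nCk+nC[k+1]≡[n+1]C[k+1] m 1)) (cong (_+ m C 2) (nC1≡n m))

C2-+ : ∀ s t → (s + t) C 2 ≡ s C 2 + s * t + t C 2
C2-+ zero    t = refl
C2-+ (suc s) t = begin
  suc (s + t) C 2                      ≡⟨ C2-suc (s + t) ⟩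
  s + t + (s + t) C 2                  ≡⟨ cong (s + t +_) (C2-+ s t) ⟩
  s + t + (s C 2 + s * t + t C 2)      ≡⟨ regroup s t (s C 2) (t C 2) ⟩
  s + s C 2 + (t + s * t) + t C 2      ≡⟨ cong (λ c → c + suc s * t + t C 2) (sym (C2-suc s)) ⟩
  suc s C 2 + suc s * t + t C 2        ∎
  where
  open ≡-Reasoning
  regroup : ∀ s t a b → s + t + (a + s * t + b) ≡ s + a + (t + s * t) + b
  regroup = solve-∀

length-hatFamily : ∀ n a s u → length (hatFamily n a s u) ≡ profileCount n s (atLeast a u)
length-hatFamily n a s u = length-profileFamily n s (atLeast a u)

length-hatFamily-2-2 : ∀ s t → length (hatFamily (s + t) 2 s 2) ≡ s C 2
length-hatFamily-2-2 s t = begin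
  length (hatFamily (s + t) 2 s 2)       ≡⟨ length-hatFamily (s + t) 2 s 2 ⟩
  profileCount (s + t) s (atLeast 2 2)   ≡⟨ profileCount-atLeast-last (s + t) s 2 2 (λ i k _ i≤k k≡2 → subst (i ≤_) k≡2 i≤k) ⟩
  profileCount (s + t) s (exactly 2 2)   ≡⟨ profileCount-exactly s t 2 0 refl ⟩
  (s C 2) * 1                            ≡⟨ *-identityʳ _ ⟩
  s C 2                                  ∎
  where open ≡-Reasoning

length-hatFamily-2-1 : ∀ s t → length (hatFamily (s + t) 2 s 1) ≡ s * t + s C 2
length-hatFamily-2-1 s t = begin
  length (hatFamily (s + t) 2 s 1)
    ≡⟨ length-hatFamily (s + t) 2 s 1 ⟩
  profileCount (s + t) s (atLeast 2 1)
    ≡⟨ profileCount-atLeast-unfold (s + t) s 2 1 ⟩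
  profileCount (s + t) s (exactly 1 2) + profileCount (s + t) s (atLeast 2 2)
    ≡⟨ cong₂ _+_ (profileCount-exactly s t 1 1 refl) (sym (length-hatFamily (s + t) 2 s 2)) ⟩
  (s C 1) * (t C 1) + length (hatFamily (s + t) 2 s 2)
    ≡⟨ cong₂ _+_ (cong₂ _*_ (nC1≡n s) (nC1≡n t)) (length-hatFamily-2-2 s t) ⟩
  s * t + s C 2
    ∎
  where open ≡-Reasoning

length-hatFamily-2-≥3 : ∀ n s u → 3 ≤ u → length (hatFamily n 2 s u) ≡ 0
length-hatFamily-2-≥3 n s u 3≤u =
  trans (length-hatFamily n 2 s u)
        (profileCount-atLeast-empty n s 2 u (λ i k _ i≤k k≡2 → <-≤-trans (s≤s (subst (i ≤_) k≡2 i≤k)) 3≤u))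

length-hatFamily-n∸2-s : ∀ s t → .{{NonZero s}} → length (hatFamily (s + t) (s + t ∸ 2) s s) ≡ t C 2
length-hatFamily-n∸2-s s t with 2 ≤? t
... | yes 2≤t = begin
  length (hatFamily (s + t) (s + t ∸ 2) s s)
    ≡⟨ length-hatFamily (s + t) (s + t ∸ 2) s s ⟩
  profileCount (s + t) s (atLeast (s + t ∸ 2) s)
    ≡⟨ profileCount-atLeast-last (s + t) s (s + t ∸ 2) s (λ i k i≤s _ _ → i≤s) ⟩
  profileCount (s + t) s (exactly s (s + t ∸ 2))
    ≡⟨ profileCount-exactly s t s (t ∸ 2) (sym (+-∸-assoc s 2≤t)) ⟩
  (s C s) * (t C (t ∸ 2))
    ≡⟨ cong₂ _*_ (nCn≡1 s) (C-∸ 2≤t) ⟩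
  1 * (t C 2)
    ≡⟨ *-identityˡ _ ⟩
  t C 2
    ∎
  where open ≡-Reasoning
... | no 2≰t =
  trans (length-hatFamily (s + t) (s + t ∸ 2) s s)
        (trans (profileCount-atLeast-empty (s + t) s (s + t ∸ 2) s
                  (λ i k _ i≤k k≡a → ≤-<-trans (subst (i ≤_) k≡a i≤k) (m<n+o⇒m∸n<o (s + t) 2 n<2+s)))
               (sym (k>n⇒nCk≡0 t<2)))
  where
  t<2 : t < 2
  t<2 = ≰⇒> 2≰t
  n<2+s : s + t < 2 + s
  n<2+s = subst (s + t <_) (+-comm s 2) (+-monoʳ-< s t<2)

length-hatFamily-n∸2-s∸1 : ∀ v t → .{{NonZero v}} →
  length (hatFamily (suc v + t) (suc v + t ∸ 2) (suc v) v) ≡ suc v * t + t C 2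
length-hatFamily-n∸2-s∸1 v zero =
  trans (length-hatFamily (suc v + 0) (suc v + 0 ∸ 2) (suc v) v)
        (trans (profileCount-atLeast-empty (suc v + 0) (suc v) (suc v + 0 ∸ 2) v
                  (λ i k _ i≤k k≡a → ≤-<-trans (subst (i ≤_) k≡a i≤k) (m<n+o⇒m∸n<o (suc v + 0) 2 n<2+v)))
               (sym (trans (+-identityʳ (suc v * 0)) (*-zeroʳ (suc v)))))
  where
  n<2+v : suc v + 0 < 2 + v
  n<2+v = s≤s (s≤s (≤-reflexive (+-identityʳ v)))
length-hatFamily-n∸2-s∸1 v (suc t) = begin
  length (hatFamily n (n ∸ 2) (suc v) v)
    ≡⟨ length-hatFamily n (n ∸ 2) (suc v) v ⟩
  profileCount n (suc v) (atLeast (n ∸ 2) v)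
    ≡⟨ profileCount-atLeast-unfold n (suc v) (n ∸ 2) v ⟩
  profileCount n (suc v) (exactly v (n ∸ 2)) + profileCount n (suc v) (atLeast (n ∸ 2) (suc v))
    ≡⟨ cong₂ _+_ (profileCount-exactly (suc v) (suc t) v t (sym (+-∸-assoc v (s≤s z≤n))))
                 (sym (length-hatFamily n (n ∸ 2) (suc v) (suc v))) ⟩
  (suc v C v) * (suc t C t) + length (hatFamily n (n ∸ 2) (suc v) (suc v))
    ≡⟨ cong₂ _+_ (cong₂ _*_ (trans (C-∸ {suc v} (s≤s z≤n)) (nC1≡n (suc v))) (trans (C-∸ {suc t} (s≤s z≤n)) (nC1≡n (suc t))))
                 (length-hatFamily-n∸2-s (suc v) (suc t)) ⟩
  suc v * suc t + suc t C 2
    ∎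
  where
  open ≡-Reasoning
  n = suc v + suc t

product<square-below : ∀ {a b x} → a < x → a + b ≡ x + x → a * b < x * x
product<square-below {a} {b} a<x a+b≡2x with m≤n⇒∃[o]m+o≡n a<x
... | d , refl = begin-strict
  a * b                                 ≡⟨ cong (a *_) b≡x+1+d ⟩
  a * (suc a + d + suc d)               <⟨ m<m+n _ {suc d * suc d} z<s ⟩
  a * (suc a + d + suc d) + suc d * suc d ≡⟨ square a d ⟩
  (suc a + d) * (suc a + d)             ∎
  where
  open ≤-Reasoning
  double : ∀ a d → suc a + d + (suc a + d) ≡ a + (suc a + d + suc d)
  double = solve-∀
  square : ∀ a d → a * (suc a + d + suc d) + suc d * suc d ≡ (suc a + d) * (suc a + d)
  square = solve-∀
  b≡x+1+d : b ≡ suc a + d + suc d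
  b≡x+1+d = +-cancelˡ-≡ a b _ (trans a+b≡2x (double a d))

product<square : ∀ {a b x} → a + b ≡ x + x → a ≢ x → a * b < x * x
product<square {a} {b} {x} a+b≡2x a≢x with <-cmp a x
... | tri< a<x _ _ = product<square-below a<x a+b≡2x
... | tri≈ _ a≡x _ = contradiction a≡x a≢x
... | tri> _ _ x<a =
  subst (_< x * x) (*-comm b a)
        (product<square-below (+-cancelˡ-< x b x (subst (x + b <_) a+b≡2x (+-monoˡ-< b x<a)))
                              (trans (+-comm b a) a+b≡2x))

hatProd<square : ∀ {n u v r x} → HatParams n 1 u v r → n C 2 ≡ x + x → (∀ m → m C 2 ≢ x) →
                 hatProd n 2 (n ∸ 2) u v r < x * x
hatProd<square {u = zero} ((() , _) , _) _ _
hatProd<square {u = suc zero} {v} {r} {x} (_ , _ , (1≤r , r≤n) , 1+v≡r+1) C2≡2x nonTriangular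
  with m≤n⇒∃[o]m+o≡n r≤n | suc-injective (trans 1+v≡r+1 (+-comm r 1))
... | t , refl | refl = begin-strict
  length (hatFamily (r + t) 2 r 1) * length (hatFamily (r + t) (r + t ∸ 2) r r)
    ≡⟨ cong₂ _*_ (length-hatFamily-2-1 r t) (length-hatFamily-n∸2-s r t {{>-nonZero 1≤r}}) ⟩
  (r * t + r C 2) * (t C 2)
    ≡⟨ *-comm _ (t C 2) ⟩
  (t C 2) * (r * t + r C 2)
    <⟨ product<square sizes (nonTriangular t) ⟩
  x * x
    ∎
  where
  open ≤-Reasoning
  sizes : t C 2 + (r * t + r C 2) ≡ x + x
  sizes = trans (trans (+-comm (t C 2) _) (cong (_+ t C 2) (+-comm (r * t) _))) (trans (sym (C2-+ r t)) C2≡2x)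
hatProd<square {u = suc (suc zero)} {v} {r} {x} (_ , (1≤v , _) , (_ , r≤n) , 2+v≡r+1) C2≡2x nonTriangular
  with m≤n⇒∃[o]m+o≡n r≤n | suc-injective (trans (+-comm 1 r) (sym 2+v≡r+1))
... | t , refl | refl = begin-strict
  length (hatFamily (suc v + t) 2 (suc v) 2) * length (hatFamily (suc v + t) (suc v + t ∸ 2) (suc v) v)
    ≡⟨ cong₂ _*_ (length-hatFamily-2-2 (suc v) t) (length-hatFamily-n∸2-s∸1 v t {{>-nonZero 1≤v}}) ⟩
  (suc v C 2) * (suc v * t + t C 2)
    <⟨ product<square sizes (nonTriangular (suc v)) ⟩
  x * x
    ∎
  where
  open ≤-Reasoning
  sizes : suc v C 2 + (suc v * t + t C 2) ≡ x + x
  sizes = trans (sym (+-assoc (suc v C 2) _ _)) (trans (sym (C2-+ (suc v) t)) C2≡2x)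
hatProd<square {n} {u = suc (suc (suc w))} {v} {r} {x} _ _ nonTriangular = begin-strict
  length (hatFamily n 2 r (3 + w)) * length (hatFamily n (n ∸ 2) r v)
    ≡⟨ cong (_* length (hatFamily n (n ∸ 2) r v)) (length-hatFamily-2-≥3 n r (3 + w) (s≤s (s≤s (s≤s z≤n)))) ⟩
  0
    <⟨ *-mono-≤ x>0 x>0 ⟩
  x * x
    ∎
  where
  open ≤-Reasoning
  x>0 : x > 0
  x>0 = n≢0⇒n>0 (≢-sym (nonTriangular 0))

∣initSeg∣ : ∀ {n s} → s ≤ n → ∣ initSeg n s ∣ ≡ s
∣initSeg∣ {n} {zero}  _         = empty n
  where
  empty : ∀ n → ∣ initSeg n 0 ∣ ≡ 0
  empty zero    = refl
  empty (suc n) = empty n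
∣initSeg∣ {suc n} {suc s} (s≤s s≤n) = cong suc (∣initSeg∣ s≤n)

∣p∩q∣+∣p∩∁q∣≡∣p∣ : ∀ {n} (p q : Subset n) → ∣ p ∩ q ∣ + ∣ p ∩ ∁ q ∣ ≡ ∣ p ∣
∣p∩q∣+∣p∩∁q∣≡∣p∣ []            []            = refl
∣p∩q∣+∣p∩∁q∣≡∣p∣ (inside ∷ p)  (inside ∷ q)  = cong suc (∣p∩q∣+∣p∩∁q∣≡∣p∣ p q)
∣p∩q∣+∣p∩∁q∣≡∣p∣ (inside ∷ p)  (outside ∷ q) = trans (+-suc _ _) (cong suc (∣p∩q∣+∣p∩∁q∣≡∣p∣ p q))
∣p∩q∣+∣p∩∁q∣≡∣p∣ (outside ∷ p) (_ ∷ q)       = ∣p∩q∣+∣p∩∁q∣≡∣p∣ p q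

∣p∩r∣+∣q∩r∣≤∣r∣+∣p∩q∣ : ∀ {n} (p q r : Subset n) → ∣ p ∩ r ∣ + ∣ q ∩ r ∣ ≤ ∣ r ∣ + ∣ p ∩ q ∣
∣p∩r∣+∣q∩r∣≤∣r∣+∣p∩q∣ []            []            []            = z≤n
∣p∩r∣+∣q∩r∣≤∣r∣+∣p∩q∣ (inside ∷ p)  (inside ∷ q)  (inside ∷ r)  =
  s≤s (subst₂ _≤_ (sym (+-suc ∣ p ∩ r ∣ ∣ q ∩ r ∣)) (sym (+-suc ∣ r ∣ ∣ p ∩ q ∣)) (s≤s (∣p∩r∣+∣q∩r∣≤∣r∣+∣p∩q∣ p q r)))
∣p∩r∣+∣q∩r∣≤∣r∣+∣p∩q∣ (inside ∷ p)  (inside ∷ q)  (outside ∷ r) =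
  subst (∣ p ∩ r ∣ + ∣ q ∩ r ∣ ≤_) (sym (+-suc ∣ r ∣ ∣ p ∩ q ∣)) (m≤n⇒m≤1+n (∣p∩r∣+∣q∩r∣≤∣r∣+∣p∩q∣ p q r))
∣p∩r∣+∣q∩r∣≤∣r∣+∣p∩q∣ (inside ∷ p)  (outside ∷ q) (inside ∷ r)  = s≤s (∣p∩r∣+∣q∩r∣≤∣r∣+∣p∩q∣ p q r)
∣p∩r∣+∣q∩r∣≤∣r∣+∣p∩q∣ (outside ∷ p) (inside ∷ q)  (inside ∷ r)  =
  subst (_≤ suc (∣ r ∣ + ∣ p ∩ q ∣)) (sym (+-suc ∣ p ∩ r ∣ ∣ q ∩ r ∣)) (s≤s (∣p∩r∣+∣q∩r∣≤∣r∣+∣p∩q∣ p q r))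
∣p∩r∣+∣q∩r∣≤∣r∣+∣p∩q∣ (outside ∷ p) (outside ∷ q) (inside ∷ r)  = m≤n⇒m≤1+n (∣p∩r∣+∣q∩r∣≤∣r∣+∣p∩q∣ p q r)
∣p∩r∣+∣q∩r∣≤∣r∣+∣p∩q∣ (inside ∷ p)  (outside ∷ q) (outside ∷ r) = ∣p∩r∣+∣q∩r∣≤∣r∣+∣p∩q∣ p q r
∣p∩r∣+∣q∩r∣≤∣r∣+∣p∩q∣ (outside ∷ p) (inside ∷ q)  (outside ∷ r) = ∣p∩r∣+∣q∩r∣≤∣r∣+∣p∩q∣ p q r
∣p∩r∣+∣q∩r∣≤∣r∣+∣p∩q∣ (outside ∷ p) (outside ∷ q) (outside ∷ r) = ∣p∩r∣+∣q∩r∣≤∣r∣+∣p∩q∣ p q r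

∣r∣<∣p∩r∣+∣q∩r∣⇒∣p∩q∣>0 : ∀ {n} (p q r : Subset n) → ∣ r ∣ < ∣ p ∩ r ∣ + ∣ q ∩ r ∣ → ∣ p ∩ q ∣ > 0
∣r∣<∣p∩r∣+∣q∩r∣⇒∣p∩q∣>0 p q r overfull = +-cancelˡ-< (∣ r ∣) 0 (∣ p ∩ q ∣) (begin-strict
  ∣ r ∣ + 0                  ≡⟨ +-identityʳ ∣ r ∣ ⟩
  ∣ r ∣                      <⟨ overfull ⟩
  ∣ p ∩ r ∣ + ∣ q ∩ r ∣      ≤⟨ ∣p∩r∣+∣q∩r∣≤∣r∣+∣p∩q∣ p q r ⟩
  ∣ r ∣ + ∣ p ∩ q ∣          ∎)
  where open ≤-Reasoning

module _ (s t : ℕ) where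

  sideCover : Profile
  sideCover i k = exactly s (s + t ∸ 2) i k ∨ exactly (s ∸ 2) (s + t ∸ 2) i k

  splitPairs sideCovers : Family (s + t)
  splitPairs = profileFamily (s + t) s (exactly 1 2)
  sideCovers = profileFamily (s + t) s sideCover

  length-splitPairs : length splitPairs ≡ s * t
  length-splitPairs =
    trans (length-profileFamily (s + t) s (exactly 1 2))
          (trans (profileCount-exactly s t 1 1 refl) (cong₂ _*_ (nC1≡n s) (nC1≡n t)))

  length-sideCovers : 2 ≤ s → 2 ≤ t → length sideCovers ≡ s C 2 + t C 2
  length-sideCovers 2≤s 2≤t = begin
    length sideCovers
      ≡⟨ length-profileFamily (s + t) s sideCover ⟩
    profileCount (s + t) s sideCover
      ≡⟨ profileCount-∨ (s + t) s (exactly-disjoint (λ s≡s∸2 → <⇒≢ (∸-monoʳ-< {s} z<s 2≤s) (sym s≡s∸2)) _) ⟩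
    profileCount (s + t) s (exactly s (s + t ∸ 2)) + profileCount (s + t) s (exactly (s ∸ 2) (s + t ∸ 2))
      ≡⟨ cong₂ _+_ (profileCount-exactly s t s (t ∸ 2) (sym (+-∸-assoc s 2≤t)))
                   (profileCount-exactly s t (s ∸ 2) t (sym (+-∸-comm t 2≤s))) ⟩
    (s C s) * (t C (t ∸ 2)) + (s C (s ∸ 2)) * (t C t)
      ≡⟨ cong₂ _+_ (cong₂ _*_ (nCn≡1 s) (C-∸ 2≤t)) (cong₂ _*_ (C-∸ 2≤s) (nCn≡1 t)) ⟩
    1 * (t C 2) + (s C 2) * 1
      ≡⟨ cong₂ _+_ (*-identityˡ (t C 2)) (*-identityʳ (s C 2)) ⟩
    t C 2 + s C 2
      ≡⟨ +-comm (t C 2) (s C 2) ⟩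
    s C 2 + t C 2
      ∎
    where open ≡-Reasoning

  sideCover-sound : ∀ i k → T (sideCover i k) → (i ≡ s ⊎ i ≡ s ∸ 2) × k ≡ s + t ∸ 2
  sideCover-sound i k cover with Equivalence.to (T-∨ {exactly s (s + t ∸ 2) i k}) cover
  ... | inj₁ coversS  = map₁ inj₁ (exactly-sound s _ i k coversS)
  ... | inj₂ coversS∁ = map₁ inj₂ (exactly-sound (s ∸ 2) _ i k coversS∁)

  private
    S = initSeg (s + t) s

  splitPairs-sideCovers-cross : 2 ≤ s → 2 ≤ t → ∀ A B →
    T (exactly 1 2 ∣ A ∩ S ∣ ∣ A ∣) → T (sideCover ∣ B ∩ S ∣ ∣ B ∣) → 1 ≤ ∣ A ∩ B ∣
  splitPairs-sideCovers-cross 2≤s 2≤t A B A-split B-cover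
    with exactly-sound 1 2 ∣ A ∩ S ∣ ∣ A ∣ A-split | sideCover-sound ∣ B ∩ S ∣ ∣ B ∣ B-cover
  ... | ∣A∩S∣≡1 , _ | inj₁ ∣B∩S∣≡s , _ =
    ∣r∣<∣p∩r∣+∣q∩r∣⇒∣p∩q∣>0 A B S (subst₂ (λ a b → ∣ S ∣ < a + b) (sym ∣A∩S∣≡1) (sym ∣B∩S∣≡s) ∣S∣<1+s)
    where
    ∣S∣<1+s : ∣ S ∣ < 1 + s
    ∣S∣<1+s = s≤s (≤-reflexive (∣initSeg∣ (m≤m+n s t)))
  ... | ∣A∩S∣≡1 , ∣A∣≡2 | inj₂ ∣B∩S∣≡s∸2 , ∣B∣≡n∸2 =
    ∣r∣<∣p∩r∣+∣q∩r∣⇒∣p∩q∣>0 A B (∁ S) (subst₂ (λ a b → ∣ ∁ S ∣ < a + b) (sym ∣A∩S∁∣≡1) (sym ∣B∩S∁∣≡t) ∣S∁∣<1+t)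
    where
    ∣S∁∣<1+t : ∣ ∁ S ∣ < 1 + t
    ∣S∁∣<1+t = s≤s (≤-reflexive (trans (∣∁p∣≡n∸∣p∣ S) (trans (cong (s + t ∸_) (∣initSeg∣ (m≤m+n s t))) (m+n∸m≡n s t))))
    ∣A∩S∁∣≡1 : ∣ A ∩ ∁ S ∣ ≡ 1
    ∣A∩S∁∣≡1 = +-cancelˡ-≡ 1 _ 1 (trans (cong (_+ ∣ A ∩ ∁ S ∣) (sym ∣A∩S∣≡1)) (trans (∣p∩q∣+∣p∩∁q∣≡∣p∣ A S) ∣A∣≡2))
    ∣B∩S∁∣≡t : ∣ B ∩ ∁ S ∣ ≡ t
    ∣B∩S∁∣≡t = +-cancelˡ-≡ (s ∸ 2) _ t
      (trans (cong (_+ ∣ B ∩ ∁ S ∣) (sym ∣B∩S∣≡s∸2))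
             (trans (∣p∩q∣+∣p∩∁q∣≡∣p∣ B S) (trans ∣B∣≡n∸2 (+-∸-comm t 2≤s))))

  splitPairs-sideCovers-admissible : 2 ≤ s → 2 ≤ t → Admissible (s + t) 2 (s + t ∸ 2) 1 splitPairs sideCovers
  splitPairs-sideCovers-admissible 2≤s 2≤t =
    profileFamily-unique (s + t) s (exactly 1 2) ,
    profileFamily-unique (s + t) s sideCover ,
    profileFamily-All (s + t) s (exactly 1 2) (λ A A-split → proj₂ (exactly-sound 1 2 ∣ A ∩ S ∣ ∣ A ∣ A-split)) ,
    profileFamily-All (s + t) s sideCover (λ B B-cover → proj₂ (sideCover-sound ∣ B ∩ S ∣ ∣ B ∣ B-cover)) ,
    profileFamily-All (s + t) s (exactly 1 2) (λ A A-split →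
      profileFamily-All (s + t) s sideCover (λ B B-cover → splitPairs-sideCovers-cross 2≤s 2≤t A B A-split B-cover))

Nhat<Nprod : ∀ {s t} → 2 ≤ s → 2 ≤ t → s C 2 + t C 2 ≡ s * t → (∀ m → m C 2 ≢ s * t) →
             ∀ N Nh → IsNprod (s + t) 2 (s + t ∸ 2) 1 N → IsNhat (s + t) 2 (s + t ∸ 2) 1 Nh → Nh < N
Nhat<Nprod {s} {t} 2≤s 2≤t balanced nonTriangular N _ (_ , maximal) ((u , v , r , params , refl) , _) = begin-strict
  hatProd (s + t) 2 (s + t ∸ 2) u v r                 <⟨ hatProd<square params C2≡2x nonTriangular ⟩
  (s * t) * (s * t)                                   ≡⟨ cong₂ _*_ (length-splitPairs s t) sideCovers≡st ⟨
  length (splitPairs s t) * length (sideCovers s t)   ≤⟨ maximal _ _ (splitPairs-sideCovers-admissible s t 2≤s 2≤t) ⟩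
  N                                                   ∎
  where
  open ≤-Reasoning
  sideCovers≡st : length (sideCovers s t) ≡ s * t
  sideCovers≡st = trans (length-sideCovers s t 2≤s 2≤t) balanced
  C2≡2x : (s + t) C 2 ≡ s * t + s * t
  C2≡2x = begin-equality
    (s + t) C 2                   ≡⟨ C2-+ s t ⟩
    s C 2 + s * t + t C 2         ≡⟨ cong (_+ t C 2) (+-comm (s C 2) (s * t)) ⟩
    s * t + s C 2 + t C 2         ≡⟨ +-assoc (s * t) (s C 2) (t C 2) ⟩
    s * t + (s C 2 + t C 2)       ≡⟨ cong (s * t +_) balanced ⟩
    s * t + s * t                 ∎

2*C2+m≡m*m : ∀ m → 2 * (m C 2) + m ≡ m * m
2*C2+m≡m*m zero    = refl
2*C2+m≡m*m (suc m) = begin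
  2 * (suc m C 2) + suc m       ≡⟨ cong (λ c → 2 * c + suc m) (C2-suc m) ⟩
  2 * (m + m C 2) + suc m       ≡⟨ regroup m (m C 2) ⟩
  (2 * (m C 2) + m) + (2 * m + 1) ≡⟨ cong (_+ (2 * m + 1)) (2*C2+m≡m*m m) ⟩
  m * m + (2 * m + 1)           ≡⟨ square m ⟩
  suc m * suc m                 ∎
  where
  open ≡-Reasoning
  regroup : ∀ m c → 2 * (m + c) + suc m ≡ (2 * c + m) + (2 * m + 1)
  regroup = solve-∀
  square : ∀ m → m * m + (2 * m + 1) ≡ suc m * suc m
  square = solve-∀

C2+C2≡* : ∀ s t → s * s + t * t ≡ 2 * (s * t) + (s + t) → s C 2 + t C 2 ≡ s * t
C2+C2≡* s t squares = *-cancelˡ-≡ _ _ 2 (+-cancelʳ-≡ (s + t) _ _ (begin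
  2 * (s C 2 + t C 2) + (s + t)           ≡⟨ regroup (s C 2) (t C 2) s t ⟩
  (2 * (s C 2) + s) + (2 * (t C 2) + t)   ≡⟨ cong₂ _+_ (2*C2+m≡m*m s) (2*C2+m≡m*m t) ⟩
  s * s + t * t                           ≡⟨ squares ⟩
  2 * (s * t) + (s + t)                   ∎))
  where
  open ≡-Reasoning
  regroup : ∀ a b s t → 2 * (a + b) + (s + t) ≡ (2 * a + s) + (2 * b + t)
  regroup = solve-∀

C2%7≢4 : ∀ m → (m C 2) % 7 ≢ 4
C2%7≢4 0 ()
C2%7≢4 1 ()
C2%7≢4 2 ()
C2%7≢4 3 ()
C2%7≢4 4 ()
C2%7≢4 5 ()
C2%7≢4 6 ()
C2%7≢4 (suc (suc (suc (suc (suc (suc (suc m))))))) C2%7≡4 = C2%7≢4 m (begin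
  (m C 2) % 7                  ≡⟨ [m+kn]%n≡m%n (m C 2) (m + 3) 7 ⟨
  (m C 2 + (m + 3) * 7) % 7    ≡⟨ cong (_% 7) shift ⟨
  ((7 + m) C 2) % 7            ≡⟨ C2%7≡4 ⟩
  4                            ∎)
  where
  open ≡-Reasoning
  regroup : ∀ m c → 21 + 7 * m + c ≡ c + (m + 3) * 7
  regroup = solve-∀
  shift : (7 + m) C 2 ≡ m C 2 + (m + 3) * 7
  shift = trans (C2-+ 7 m) (regroup m (m C 2))

-- C(2c, 2) and C(2c + 1, 2) for c = suc e.
lowerSide upperSide : ℕ → ℕ
lowerSide e = suc e * (1 + 2 * e)
upperSide e = suc e * (3 + 2 * e)

sides-balanced : ∀ e → lowerSide e C 2 + upperSide e C 2 ≡ lowerSide e * upperSide e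
sides-balanced e = C2+C2≡* (lowerSide e) (upperSide e) (squares e)
  where
  squares : ∀ e → let s = suc e * (1 + 2 * e); t = suc e * (3 + 2 * e) in
            s * s + t * t ≡ 2 * (s * t) + (s + t)
  squares = solve-∀

sides-%7 : ∀ k → (lowerSide (1 + k * 7) * upperSide (1 + k * 7)) % 7 ≡ 4
sides-%7 k = begin
  (lowerSide e * upperSide e) % 7                   ≡⟨ %-distribˡ-* (lowerSide e) (upperSide e) 7 ⟩
  ((lowerSide e % 7) * (upperSide e % 7)) % 7       ≡⟨ cong₂ (λ a b → (a * b) % 7) lower%7 upper%7 ⟩
  (6 * 3) % 7                                       ≡⟨⟩
  4                                                 ∎
  where
  open ≡-Reasoning
  e = 1 + k * 7
  lower≡ : ∀ k → suc (1 + k * 7) * (1 + 2 * (1 + k * 7)) ≡ 6 + k * (7 + 14 * k) * 7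
  lower≡ = solve-∀
  upper≡ : ∀ k → suc (1 + k * 7) * (3 + 2 * (1 + k * 7)) ≡ 3 + (1 + k * (9 + 14 * k)) * 7
  upper≡ = solve-∀
  lower%7 : lowerSide e % 7 ≡ 6
  lower%7 = trans (cong (_% 7) (lower≡ k)) ([m+kn]%n≡m%n 6 (k * (7 + 14 * k)) 7)
  upper%7 : upperSide e % 7 ≡ 3
  upper%7 = trans (cong (_% 7) (upper≡ k)) ([m+kn]%n≡m%n 3 (1 + k * (9 + 14 * k)) 7)

proposition1 : ∀ (m : ℕ) → ∃[ n ] (m ≤ n × 1 ≤ n ×
                 (∀ N Nh → IsNprod n 2 (n ∸ 2) 1 N → IsNhat n 2 (n ∸ 2) 1 Nh → Nh < N))
proposition1 m = s + t , m≤n , ≤-trans (s≤s z≤n) 2≤n , Nhat<Nprod 2≤s 2≤t (sides-balanced e) nonTriangular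
  where
  open ≤-Reasoning
  e = 1 + m * 7
  s = lowerSide e
  t = upperSide e
  2≤s : 2 ≤ s
  2≤s = ≤-trans (s≤s (s≤s z≤n)) (m≤m*n (suc e) (1 + 2 * e))
  2≤t : 2 ≤ t
  2≤t = ≤-trans (s≤s (s≤s z≤n)) (m≤m*n (suc e) (3 + 2 * e))
  2≤n : 2 ≤ s + t
  2≤n = ≤-trans 2≤s (m≤m+n s t)
  m≤n : m ≤ s + t
  m≤n = begin
    m         ≤⟨ m≤m*n m 7 ⟩
    m * 7     ≤⟨ n≤1+n _ ⟩
    e         ≤⟨ n≤1+n e ⟩
    suc e     ≤⟨ m≤m*n (suc e) (1 + 2 * e) ⟩
    s         ≤⟨ m≤m+n s t ⟩
    s + t     ∎
  nonTriangular : ∀ j → j C 2 ≢ s * t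
  nonTriangular j j₂≡st = C2%7≢4 j (trans (cong (_% 7) j₂≡st) (sides-%7 m))
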